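{- For every $k\ge 0$ and $\mathcal{V}=(\emptyset,\sigma_c,\sigma_r)$, the triple $(\mathbb{E}_k,\varepsilon,(\cdot)^*)$ is a comonad in Kleisli form on the category of $\mathcal{V}$-pointed interpretations. Explicitly: for all objects $(\mathcal{I},d),(\mathcal{J},e),(\mathcal{K},c)$ and morphisms $f:\mathbb{E}_k(\mathcal{I},d)\to(\mathcal{J},e)$, $g:\mathbb{E}_k(\mathcal{J},e)\to(\mathcal{K},c)$: (A) $\varepsilon_{(\mathcal{I},d)}^*=\mathrm{id}_{\mathbb{E}_k(\mathcal{I},d)}$; (B) $\varepsilon_{(\mathcal{J},e)}\circ f^*=f$; (C) $(g\circ f^*)^*=g^*\circ f^*$; (D) $f^*$ is a morphism $\mathbb{E}_k(\mathcal{I},d)\to\mathbb{E}_k(\mathcal{J},e)$.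
   Context: A $\mathcal{V}$-pointed interpretation $(\mathcal{I},d)$ for $\mathcal{V}=(\emptyset,\sigma_c,\sigma_r)$ ($\sigma_c,\sigma_r$ finite sets of concept and role names) is an interpretation $\mathcal{I}$ (nonempty domain $\Delta^{\mathcal{I}}$, concept names interpreted as subsets, role names as binary relations, names outside $\mathcal{V}$ interpreted as $\emptyset$) with $d\in\Delta^{\mathcal{I}}$. The category of $\mathcal{V}$-pointed interpretations has these as objects; a morphism $h:(\mathcal{I},d)\to(\mathcal{J},e)$ is a map $\Delta^{\mathcal{I}}\to\Delta^{\mathcal{J}}$ with $h(d)=e$ such that $x\in A^{\mathcal{I}}\Rightarrow h(x)\in A^{\mathcal{J}}$ for $A\in\sigma_c$ and $(x,y)\in r^{\mathcal{I}}\Rightarrow(h(x),h(y))\in r^{\mathcal{J}}$ for $r\in\sigma_r$. $\mathbb{E}_k(\mathcal{I},d)$: domain = sequences $[a_0,r_1,a_1,\dots,r_j,a_j]$ with $0\le j\le k$, $a_0=d$, $r_i\in\sigma_r$, $(a_{i-1},a_i)\in r_i^{\mathcal{I}}$; distinguished element $[d]$; $s\in A^{\mathbb{E}_k(\mathcal{I},d)}$ iff the last element of $s$ is in $A^{\mathcal{I}}$; $(s,t)\in r^{\mathbb{E}_k(\mathcal{I},d)}$ iff $t=s[r,d']$ (the sequence $s$ extended by $r,d'$) for some $d'$. On morphisms $\mathbb{E}_k h[a_0,r_1,\dots,r_j,a_j]=[h(a_0),r_1,\dots,r_j,h(a_j)]$. The counit $\varepsilon_{(\mathcal{I},d)}$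 sends a sequence to its last element. Kleisli coextension: for $h:\mathbb{E}_k(\mathcal{I},d)\to(\mathcal{J},e)$, $h^*:\mathbb{E}_k(\mathcal{I},d)\to\mathbb{E}_k(\mathcal{J},e)$ is defined recursively by $h^*[d]=[e]$ and $h^*(s[r,d'])=h^*(s)[r,h(s[r,d'])]$. -}

module Defs where

open import Data.Nat using (ℕ; zero; suc; _≤_; z≤n)
open import Data.Nat.Properties using (<⇒≤)
open import Data.Fin using (Fin)
open import Data.Product using (∃; _,_)
open import Relation.Binary.PropositionalEquality using (_≡_; refl; sym; trans; cong; subst)

-- Vocabulary V = (∅, σ_c, σ_r) with σ_c = Fin nc (concept names) and
-- σ_r = Fin nr (role names).  Names outside V are interpreted as ∅,
-- so an interpretation only needs to interpret the names in V.
--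
-- Subsets are encoded as proposition-valued predicates (membership
-- proofs are unique), matching the set-theoretic reading
-- A^I ⊆ Δ^I and r^I ⊆ Δ^I × Δ^I.

record Interp (nc nr : ℕ) : Set₁ where
  field
    Δ         : Set
    conc      : Fin nc → Δ → Set
    role      : Fin nr → Δ → Δ → Set
    conc-prop : ∀ A x (p q : conc A x) → p ≡ q
    role-prop : ∀ r x y (p q : role r x y) → p ≡ q

record Pointed (nc nr : ℕ) : Set₁ where
  field
    interp : Interp nc nr
    pt     : Interp.Δ interp
  open Interp interp public

open Pointed

record Hom {nc nr : ℕ} (P Q : Pointed nc nr) : Set where
  field
    fun       : Δ P → Δ Q
    pres-pt   : fun (pt P) ≡ pt Q
    pres-conc : ∀ A x → conc P A x → conc Q A (fun x)
    pres-role : ∀ r x y → role P r x y → role Q r (fun x) (fun y)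

open Hom

_∘H_ : ∀ {nc nr} {P Q R : Pointed nc nr} → Hom Q R → Hom P Q → Hom P R
fun (g ∘H f) x = fun g (fun f x)
pres-pt (g ∘H f) = trans (cong (fun g) (pres-pt f)) (pres-pt g)
pres-conc (g ∘H f) A x p = pres-conc g A (fun f x) (pres-conc f A x p)
pres-role (g ∘H f) r x y p = pres-role g r (fun f x) (fun f y) (pres-role f r x y p)

-- Sequences [a_0, r_1, a_1, ..., r_j, a_j] with a_0 = d.  Since a_0 is
-- forced to be the distinguished element d, the sequence [d] is
-- represented by 'root', and s[r,a] by 'snoc s r a'.

data Seq (D : Set) (nr : ℕ) : Set where
  root : Seq D nr
  snoc : Seq D nr → Fin nr → D → Seq D nr

len : ∀ {D nr} → Seq D nr → ℕ
len root         = zero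
len (snoc s _ _) = suc (len s)

module _ {nc nr : ℕ} (P : Pointed nc nr) where

  lastE : Seq (Δ P) nr → Δ P
  lastE root         = pt P
  lastE (snoc _ _ a) = a

  data Valid : Seq (Δ P) nr → Set where
    start : Valid root
    step  : ∀ {s r a} → Valid s → role P r (lastE s) a → Valid (snoc s r a)

record Elem {nc nr : ℕ} (k : ℕ) (P : Pointed nc nr) : Set where
  constructor elem
  field
    seq   : Seq (Δ P) nr
    valid : Valid P seq
    bound : len seq ≤ k

open Elem

module _ {nc nr : ℕ} (k : ℕ) (P : Pointed nc nr) where

  private
    ext-prop : ∀ r (x y : Elem k P) (p q : ∃ λ a → seq y ≡ snoc (seq x) r a) → p ≡ q
    ext-prop r x y (a , refl) (.a , refl) = refl

  EInterp : Interp nc nr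
  Interp.Δ EInterp         = Elem k P
  Interp.conc EInterp A s  = conc P A (lastE P (seq s))
  Interp.role EInterp r s t = ∃ λ a → seq t ≡ snoc (seq s) r a
  Interp.conc-prop EInterp A s = conc-prop P A (lastE P (seq s))
  Interp.role-prop EInterp = ext-prop

  E : Pointed nc nr
  interp E = EInterp
  pt E     = elem root start z≤n

  ε : Hom E P
  fun ε x = lastE P (seq x)
  pres-pt ε = refl
  pres-conc ε A x p = p
  pres-role ε r (elem s v l) (elem .(snoc s r a) (step w p) m) (a , refl) = p

module _ {nc nr : ℕ} {k : ℕ} {P Q : Pointed nc nr} (h : Hom (E k P) Q) where

  coseq : (s : Seq (Δ P) nr) → Valid P s → len s ≤ k → Seq (Δ Q) nr
  coseq root         _          _ = root
  coseq (snoc s r a) (step v p) l =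
    snoc (coseq s v (<⇒≤ l)) r (fun h (elem (snoc s r a) (step v p) l))

  colast : ∀ s v l → lastE Q (coseq s v l) ≡ fun h (elem s v l)
  colast root         start      z≤n = sym (pres-pt h)
  colast (snoc s r a) (step v p) l   = refl

  colen : ∀ s v l → len (coseq s v l) ≡ len s
  colen root         start      l = refl
  colen (snoc s r a) (step v p) l rewrite colen s v (<⇒≤ l) = refl

  covalid : ∀ s v l → Valid Q (coseq s v l)
  covalid root         start      l = start
  covalid (snoc s r a) (step v p) l =
    step (covalid s v (<⇒≤ l))
         (subst (λ z → role Q r z (fun h (elem (snoc s r a) (step v p) l)))
                (sym (colast s v (<⇒≤ l)))
                (pres-role h r (elem s v (<⇒≤ l)) (elem (snoc s r a) (step v p) l) (a , refl)))

  cofun : Elem k P → Elem k Q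
  cofun (elem s v l) =
    elem (coseq s v l) (covalid s v l) (subst (λ n → n ≤ k) (sym (colen s v l)) l)

-- h* as a map of underlying domains; that it is a morphism
-- E_k(I,d) → E_k(J,e) is part (D) of the statement.
_* : ∀ {nc nr k} {P Q : Pointed nc nr} → Hom (E k P) Q → Elem k P → Elem k Q
h * = cofun h

record IsHom {nc nr : ℕ} (P Q : Pointed nc nr) (f : Δ P → Δ Q) : Set where
  field
    pres-pt   : f (pt P) ≡ pt Q
    pres-conc : ∀ A x → conc P A x → conc Q A (f x)
    pres-role : ∀ r x y → role P r x y → role Q r (f x) (f y)

toHom : ∀ {nc nr} {P Q : Pointed nc nr} (f : Δ P → Δ Q) → IsHom P Q f → Hom P Q
fun (toHom f H) = f
pres-pt (toHom f H) = IsHom.pres-pt H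
pres-conc (toHom f H) = IsHom.pres-conc H
pres-role (toHom f H) = IsHom.pres-role H

{-# OPTIONS --safe #-}
-- Validity and length-bound proofs are proof-irrelevant, so an element of E_k(I,d) is
-- determined by its underlying sequence. Each law therefore reduces to an equation
-- between sequences, proved by induction on the sequence: the coextension rebuilds a
-- sequence step by step, and at each step both sides apply the same map to the same
-- prefix.
module Submission where

open import Defs
open import Data.Nat using (ℕ)
open import Data.Nat.Properties using (≤-irrelevant; <⇒≤)
open import Data.Product using (Σ; _×_; _,_)
open import Relation.Binary.PropositionalEquality using (_≡_; refl; sym; cong; cong₂; subst)

open Pointed
open Hom
open Elem

valid-irrelevant : ∀ {nc nr} (P : Pointed nc nr) {s} (v w : Valid P s) → v ≡ w
valid-irrelevant P start start = refl
valid-irrelevant P (step {s} {r} {a} v p) (step w q) =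
  cong₂ step (valid-irrelevant P v w) (role-prop P r (lastE P s) a p q)

seq-injective : ∀ {nc nr k} {P : Pointed nc nr} {x y : Elem k P} → seq x ≡ seq y → x ≡ y
seq-injective {P = P} {elem s v l} {elem .s w m} refl =
  cong₂ (elem s) (valid-irrelevant P v w) (≤-irrelevant l m)

module _ {nc nr k : ℕ} {P Q : Pointed nc nr} (h : Hom (E k P) Q) where

  coseq-irrelevant : ∀ s v v′ l l′ → coseq h s v l ≡ coseq h s v′ l′
  coseq-irrelevant s v v′ l l′ rewrite valid-irrelevant P v v′ | ≤-irrelevant l l′ = refl

  coext-isHom : IsHom (E k P) (E k Q) (h *)
  IsHom.pres-pt coext-isHom = refl
  IsHom.pres-conc coext-isHom A (elem s v l) c =
    subst (conc Q A) (sym (colast h s v l)) (pres-conc h A (elem s v l) c)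
  IsHom.pres-role coext-isHom r (elem s v′ l′) (elem .(snoc s r a) (step v p) l) (a , refl) =
    _ , cong (λ z → snoc z r _) (coseq-irrelevant s v v′ (<⇒≤ l) l′)

  counit-coext : ∀ x → fun (ε k Q) ((h *) x) ≡ fun h x
  counit-coext (elem s v l) = colast h s v l

coseq-counit : ∀ {nc nr k} (P : Pointed nc nr) s v l → coseq (ε k P) s v l ≡ s
coseq-counit P root         start      l = refl
coseq-counit P (snoc s r a) (step v p) l = cong (λ z → snoc z r a) (coseq-counit P s v (<⇒≤ l))

coseq-∘ : ∀ {nc nr k} {P Q R : Pointed nc nr} (f : Hom (E k P) Q) (g : Hom (E k Q) R) →
  ∀ s v l v′ l′ → coseq (g ∘H toHom (f *) (coext-isHom f)) s v l ≡ coseq g (coseq f s v l) v′ l′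
coseq-∘ f g root         start      l start       l′ = refl
coseq-∘ f g (snoc s r a) (step v p) l (step v′ p′) l′ =
  cong₂ (λ z w → snoc z r w)
    (coseq-∘ f g s v (<⇒≤ l) v′ (<⇒≤ l′))
    (cong (fun g) (seq-injective refl))

proposition8 : (nc nr k : ℕ) →
    Σ ((P Q : Pointed nc nr) (f : Hom (E k P) Q) → IsHom (E k P) (E k Q) (f *))
      (λ D → (P Q R : Pointed nc nr) (f : Hom (E k P) Q) (g : Hom (E k Q) R) →
        ((x : Elem k P) → (ε k P *) x ≡ x)
        × ((x : Elem k P) → Hom.fun (ε k Q) ((f *) x) ≡ Hom.fun f x)
        × ((x : Elem k P) → ((g ∘H toHom (f *) (D P Q f)) *) x ≡ (g *) ((f *) x)))
proposition8 nc nr k = (λ P Q f → coext-isHom f) , λ P Q R f g →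
    (λ { (elem s v l) → seq-injective (coseq-counit P s v l) })
  , counit-coext f
  , (λ { (elem s v l) → seq-injective (coseq-∘ f g s v l _ _) })
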